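{- Let $p$ be an odd prime and let $Z\subseteq\mathbb{Z}/p\mathbb{Z}$ with $0\in Z$ and $|Z|<(p+9)/4$. If $c_d(Z)\le 2$ for some $d\in(\mathbb{Z}/p\mathbb{Z})^*$, then there exist $u\neq 0$ and $v$ in $\mathbb{Z}/p\mathbb{Z}$ such that $u\cdot Z+v\subseteq\{0,1,\dots,(p-1)/2\}$ (elements of $\mathbb{Z}/p\mathbb{Z}$ represented by these integers).
   Context: For $d\in\mathbb{Z}/p\mathbb{Z}$ and $Z\subseteq\mathbb{Z}/p\mathbb{Z}$, a $d$-component of $Z$ is a maximal arithmetic progression of difference $d$ contained in $Z$, and $c_d(Z)$ denotes the number of $d$-components of $Z$. $u\cdot Z+v=\{uz+v: z\in Z\}$; such a set with $u\ne0$ is called an affine image of $Z$. -}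

module Defs where

open import Data.Nat using (ℕ; zero; suc; _+_; _*_; _∸_; _≤_; _<_; NonZero)
open import Data.Nat.DivMod using (_mod_)
open import Data.Fin using (Fin; toℕ)
open import Data.Fin.Subset using (Subset; _∈_)
open import Data.List using (List; length)
open import Data.List.Membership.Propositional renaming (_∈_ to _∈ₗ_)
open import Data.Product using (Σ; ∃; ∃-syntax; _×_; _,_)
open import Relation.Binary.PropositionalEquality using (_≡_)

module _ (p : ℕ) .{{_ : NonZero p}} where

  [_] : ℕ → Fin p
  [ n ] = n mod p

  _⊕_ : Fin p → Fin p → Fin p
  x ⊕ y = (toℕ x + toℕ y) mod p

  _⊗_ : Fin p → Fin p → Fin p
  x ⊗ y = (toℕ x * toℕ y) mod p

  term : Fin p → Fin p → ℕ → Fin p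
  term a d i = (toℕ a + i * toℕ d) mod p

  InAP : Fin p → Fin p → ℕ → Fin p → Set
  InAP a d k x = ∃[ i ] (i < k × x ≡ term a d i)

  APSub : Fin p → Fin p → ℕ → Subset p → Set
  APSub a d k Z = ∀ x → InAP a d k x → x ∈ Z

  APIncl : Fin p → Fin p → ℕ → Fin p → ℕ → Set
  APIncl d a k b l = ∀ x → InAP a d k x → InAP b d l x

  -- an arithmetic progression of difference d: first term a, k distinct terms, 1 ≤ k ≤ p
  ValidAP : ℕ → Set
  ValidAP k = 1 ≤ k × k ≤ p

  -- (a, k) describes a d-component of Z: a maximal arithmetic progression of
  -- difference d contained in Z
  IsComponent : Fin p → Subset p → Fin p → ℕ → Set
  IsComponent d Z a k =
    ValidAP k × APSub a d k Z ×
    (∀ b l → ValidAP l → APSub b d l Z → APIncl d a k b l → APIncl d b l a k)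

  -- c_d(Z) ≤ m : the d-components of Z (as sets) are among at most m listed ones
  AtMostComponents : Fin p → Subset p → ℕ → Set
  AtMostComponents d Z m =
    Σ (List (Fin p × ℕ)) λ L → length L ≤ m ×
      (∀ a k → IsComponent d Z a k →
         ∃ λ b → ∃ λ l → (b , l) ∈ₗ L × APIncl d a k b l × APIncl d b l a k)

-- Pick x ∉ Z (Z is too small to be everything) and walk along x, x + d, …, x + p d = x. The
-- elements of Z met on the walk form maximal runs, each of which is a d-component; since the walk
-- starts and ends outside Z, different runs are different components, so there are at most two.
-- Multiplying by d⁻¹ and translating, Z becomes a subset of two arcs of the circle ℤ/p of total
-- length k + l ≤ |Z| < (p + 9)/4. If one of the two gaps between the arcs has length at least
-- (p − 1)/2, a translation moves both arcs into {0, …, (p − 1)/2}. Otherwise both gaps are short,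
-- one arc together with the gap after it covers at least half of the circle, and doubling, with
-- the start of that arc moved to 0, folds both arcs into {0, …, (p − 1)/2}.
module Submission where

open import Defs
open import Data.Empty using (⊥; ⊥-elim)
open import Data.Fin using (Fin; toℕ)
open import Data.Fin.Properties using (toℕ-injective; toℕ-fromℕ<; toℕ<n; all?; ¬∀⟶∃¬)
open import Data.Fin.Subset using (Subset; _∈_; _∉_; ∣_∣; _-_; ⊤)
open import Data.Fin.Subset.Properties using (_∈?_; x∈p∧x≢y⇒x∈p-y; x∈p⇒∣p-x∣<∣p∣; ∣⊤∣≡n; p⊆q⇒∣p∣≤∣q∣)
open import Data.List using (List; []; _∷_; length)
open import Data.List.Membership.Propositional using () renaming (_∈_ to _∈ₗ_)
open import Data.List.Relation.Unary.Any using (here; there)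
open import Data.Nat hiding (∣_-_∣)
open import Data.Nat.Coprimality using (prime⇒coprime; coprime-Bézout)
open import Data.Nat.DivMod
open import Data.Nat.GCD using (module Bézout)
open import Data.Nat.Primality using (Prime; prime⇒nonTrivial)
open import Data.Nat.Properties
open import Data.Nat.Tactic.RingSolver using (solve-∀)
open import Data.Product using (∃; ∃₂; ∃-syntax; _×_; _,_; proj₁; proj₂; map₂)
open import Data.Sum using (_⊎_; inj₁; inj₂)
open import Function using (_∘_)
open import Relation.Binary.PropositionalEquality hiding ([_])
open import Relation.Nullary using (¬_; yes; no; contradiction)
open import Relation.Nullary.Decidable using (¬?; decidable-stable; _×-dec_)
open import Relation.Unary using (Decidable)

module Congruence (p : ℕ) .{{_ : NonZero p}} where

  infix 4 _≈_
  _≈_ : ℕ → ℕ → Set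
  m ≈ n = m % p ≡ n % p

  open ≡-Reasoning

  ≈-reflexive : ∀ {m n} → m ≡ n → m ≈ n
  ≈-reflexive = cong (_% p)

  %-≈ : ∀ m → m % p ≈ m
  %-≈ m = m%n%n≡m%n m p

  +-cong : ∀ {m m′ n n′} → m ≈ m′ → n ≈ n′ → m + n ≈ m′ + n′
  +-cong {m} {m′} {n} {n′} m≈m′ n≈n′ = begin
    (m + n) % p           ≡⟨ %-distribˡ-+ m n p ⟩
    (m % p + n % p) % p   ≡⟨ cong₂ (λ a b → (a + b) % p) m≈m′ n≈n′ ⟩
    (m′ % p + n′ % p) % p ≡⟨ %-distribˡ-+ m′ n′ p ⟨
    (m′ + n′) % p         ∎

  *-cong : ∀ {m m′ n n′} → m ≈ m′ → n ≈ n′ → m * n ≈ m′ * n′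
  *-cong {m} {m′} {n} {n′} m≈m′ n≈n′ = begin
    (m * n) % p           ≡⟨ %-distribˡ-* m n p ⟩
    (m % p * (n % p)) % p ≡⟨ cong₂ (λ a b → (a * b) % p) m≈m′ n≈n′ ⟩
    (m′ % p * (n′ % p)) % p ≡⟨ %-distribˡ-* m′ n′ p ⟨
    (m′ * n′) % p         ∎

  +-congˡ : ∀ m {n n′} → n ≈ n′ → m + n ≈ m + n′
  +-congˡ m = +-cong {m} refl

  +-congʳ : ∀ n {m m′} → m ≈ m′ → m + n ≈ m′ + n
  +-congʳ n m≈m′ = +-cong m≈m′ (refl {x = n % p})

  p≈0 : p ≈ 0
  p≈0 = trans (n%n≡0 p) (sym (m*n%n≡0 0 p))

  negate : ℕ → ℕ
  negate m = p ∸ m % p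

  +-negateʳ : ∀ m → m + negate m ≈ 0
  +-negateʳ m = begin
    (m + negate m) % p     ≡⟨ +-congʳ (negate m) (%-≈ m) ⟨
    (m % p + negate m) % p ≡⟨ ≈-reflexive (m+[n∸m]≡n (m%n≤n m p)) ⟩
    p % p                  ≡⟨ p≈0 ⟩
    0 % p                  ∎

  +-cancelʳ-≈ : ∀ c {m n} → m + c ≈ n + c → m ≈ n
  +-cancelʳ-≈ c {m} {n} m+c≈n+c = begin
    m % p                      ≡⟨ ≈-reflexive (+-identityʳ m) ⟨
    (m + 0) % p                ≡⟨ +-congˡ m (+-negateʳ c) ⟨
    (m + (c + negate c)) % p   ≡⟨ ≈-reflexive (+-assoc m c (negate c)) ⟨
    (m + c + negate c) % p     ≡⟨ +-congʳ (negate c) m+c≈n+c ⟩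
    (n + c + negate c) % p     ≡⟨ ≈-reflexive (+-assoc n c (negate c)) ⟩
    (n + (c + negate c)) % p   ≡⟨ +-congˡ n (+-negateʳ c) ⟩
    (n + 0) % p                ≡⟨ ≈-reflexive (+-identityʳ n) ⟩
    n % p                      ∎

  suc-injective-≈ : ∀ {m n} → suc m ≈ suc n → m ≈ n
  suc-injective-≈ {m} {n} 1+m≈1+n =
    +-cancelʳ-≈ 1 (trans (≈-reflexive (+-comm m 1)) (trans 1+m≈1+n (≈-reflexive (+-comm 1 n))))

  ≈⇒≡ : ∀ {m n} → m < p → n < p → m ≈ n → m ≡ n
  ≈⇒≡ {m} {n} m<p n<p m≈n = begin
    m     ≡⟨ m<n⇒m%n≡m m<p ⟨
    m % p ≡⟨ m≈n ⟩
    n % p ≡⟨ m<n⇒m%n≡m n<p ⟩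
    n     ∎

  toℕ-mod : ∀ m → toℕ (m mod p) ≡ m % p
  toℕ-mod m = toℕ-fromℕ< (m%n<n m p)

  ≈⇒mod≡ : ∀ {m n} → m ≈ n → m mod p ≡ n mod p
  ≈⇒mod≡ {m} {n} m≈n = toℕ-injective (trans (toℕ-mod m) (trans m≈n (sym (toℕ-mod n))))

  mod≡⇒≈ : ∀ {m n} → m mod p ≡ n mod p → m ≈ n
  mod≡⇒≈ {m} {n} eq = trans (sym (toℕ-mod m)) (trans (cong toℕ eq) (toℕ-mod n))

  toℕ-mod-≈ : ∀ m → toℕ (m mod p) ≈ m
  toℕ-mod-≈ m = trans (cong (_% p) (toℕ-mod m)) (%-≈ m)

  toℕ>0 : ∀ {z} → z ≢ 0 mod p → 0 < toℕ z
  toℕ>0 z≢0 = n≢0⇒n>0 λ z≡0 → z≢0 (toℕ-injective (trans z≡0 (sym (trans (toℕ-mod 0) (m*n%n≡0 0 p)))))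

  mod-toℕ : (z : Fin p) → toℕ z mod p ≡ z
  mod-toℕ z = toℕ-injective (trans (toℕ-mod (toℕ z)) (m<n⇒m%n≡m (toℕ<n z)))

  recentre : ∀ c {s o t} → t ≈ s + o → c * t + c * negate s ≈ c * o
  recentre c {s} {o} {t} t≈s+o = begin
    (c * t + c * negate s) % p       ≡⟨ +-congʳ (c * negate s) (*-cong (refl {x = c % p}) t≈s+o) ⟩
    (c * (s + o) + c * negate s) % p ≡⟨ ≈-reflexive (rearrange c s o (negate s)) ⟩
    (c * o + c * (s + negate s)) % p ≡⟨ +-congˡ (c * o) (*-cong (refl {x = c % p}) (+-negateʳ s)) ⟩
    (c * o + c * 0) % p              ≡⟨ ≈-reflexive (cong (c * o +_) (*-zeroʳ c)) ⟩
    (c * o + 0) % p                  ≡⟨ ≈-reflexive (+-identityʳ (c * o)) ⟩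
    (c * o) % p                      ∎
    where
    rearrange : ∀ c s o n → c * (s + o) + c * n ≡ c * o + c * (s + n)
    rearrange = solve-∀

module Progression (p : ℕ) .{{_ : NonZero p}} (x d : Fin p)
                   (w : ℕ) (w*d≈1 : Congruence._≈_ p (w * toℕ d) 1) where

  open Congruence p
  open ≡-Reasoning

  pt : ℕ → Fin p
  pt = term p x d

  index : Fin p → ℕ
  index z = (w * (toℕ z + negate (toℕ x))) % p

  index<p : ∀ z → index z < p
  index<p z = m%n<n _ p

  private
    X D : ℕ
    X = toℕ x
    D = toℕ d

    *-inverse : ∀ m → m * (w * D) ≈ m
    *-inverse m = trans (*-cong (refl {x = m % p}) w*d≈1) (≈-reflexive (*-identityʳ m))

  index-pt : ∀ t → index (pt t) ≈ t
  index-pt t = begin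
    index (pt t) % p                          ≡⟨ %-≈ _ ⟩
    (w * (toℕ (pt t) + negate X)) % p         ≡⟨ *-cong (refl {x = w % p}) (+-congʳ (negate X) (toℕ-mod-≈ _)) ⟩
    (w * (X + t * D + negate X)) % p          ≡⟨ ≈-reflexive (rearrange w X t D (negate X)) ⟩
    (t * (w * D) + w * (X + negate X)) % p    ≡⟨ +-cong (*-inverse t) (*-cong (refl {x = w % p}) (+-negateʳ X)) ⟩
    (t + w * 0) % p                           ≡⟨ ≈-reflexive (trans (cong (t +_) (*-zeroʳ w)) (+-identityʳ t)) ⟩
    t % p                                     ∎
    where
    rearrange : ∀ w X t D n → w * (X + t * D + n) ≡ t * (w * D) + w * (X + n)
    rearrange = solve-∀

  pt-index : ∀ z → pt (index z) ≡ z
  pt-index z = trans (≈⇒mod≡ pt-index≈) (mod-toℕ z)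
    where
    Z = toℕ z
    pt-index≈ : X + index z * D ≈ Z
    pt-index≈ = begin
      (X + index z * D) % p                        ≡⟨ +-congˡ X (*-cong (%-≈ _) (refl {x = D % p})) ⟩
      (X + w * (Z + negate X) * D) % p             ≡⟨ ≈-reflexive (rearrange X w Z (negate X) D) ⟩
      ((Z + negate X) * (w * D) + X) % p           ≡⟨ +-congʳ X (*-inverse (Z + negate X)) ⟩
      (Z + negate X + X) % p                       ≡⟨ ≈-reflexive (trans (+-assoc Z _ X) (cong (Z +_) (+-comm (negate X) X))) ⟩
      (Z + (X + negate X)) % p                     ≡⟨ +-congˡ Z (+-negateʳ X) ⟩
      (Z + 0) % p                                  ≡⟨ ≈-reflexive (+-identityʳ Z) ⟩
      Z % p                                        ∎
      where
      rearrange : ∀ X w Z n D → X + w * (Z + n) * D ≡ (Z + n) * (w * D) + X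
      rearrange = solve-∀

  pt-cong : ∀ {s t} → s ≈ t → pt s ≡ pt t
  pt-cong s≈t = ≈⇒mod≡ (+-congˡ X (*-cong s≈t (refl {x = D % p})))

  pt-injective : ∀ {s t} → pt s ≡ pt t → s ≈ t
  pt-injective {s} {t} eq = trans (sym (index-pt s)) (trans (cong (λ z → index z % p) eq) (index-pt t))

  pt-zero : pt 0 ≡ x
  pt-zero = trans (cong (_mod p) (+-identityʳ X)) (mod-toℕ x)

  term-pt : ∀ s i → term p (pt s) d i ≡ pt (s + i)
  term-pt s i = ≈⇒mod≡ (begin
    (toℕ (pt s) + i * D) % p  ≡⟨ +-congʳ (i * D) (toℕ-mod-≈ _) ⟩
    (X + s * D + i * D) % p   ≡⟨ ≈-reflexive (rearrange X s i D) ⟩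
    (X + (s + i) * D) % p     ∎)
    where
    rearrange : ∀ X s i D → X + s * D + i * D ≡ X + (s + i) * D
    rearrange = solve-∀

  term-index : ∀ b i → term p b d i ≡ pt (index b + i)
  term-index b i = subst (λ b′ → term p b′ d i ≡ pt (index b + i)) (pt-index b) (term-pt (index b) i)

  affine : ∀ c V → ∃₂ λ u v → (¬ c ≈ 0 → u ≢ 0 mod p) ×
             (∀ t → toℕ (_⊕_ p (_⊗_ p u (pt t)) v) ≡ (c * t + V) % p)
  affine c V = u , v , u≢0 , along
    where
    u v : Fin p
    u = (c * w) mod p
    v = (V + negate (c * w * X)) mod p

    u≢0 : ¬ c ≈ 0 → u ≢ 0 mod p
    u≢0 c≉0 u≡0 = c≉0 (begin
      c % p             ≡⟨ *-inverse c ⟨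
      (c * (w * D)) % p ≡⟨ ≈-reflexive (*-assoc c w D) ⟨
      (c * w * D) % p   ≡⟨ *-cong (mod≡⇒≈ u≡0) (refl {x = D % p}) ⟩
      (0 * D) % p       ∎)

    along : ∀ t → toℕ (_⊕_ p (_⊗_ p u (pt t)) v) ≡ (c * t + V) % p
    along t = begin
      toℕ (_⊕_ p (_⊗_ p u (pt t)) v)                                ≡⟨ toℕ-mod _ ⟩
      (toℕ (_⊗_ p u (pt t)) + toℕ v) % p                            ≡⟨ +-cong (toℕ-mod-≈ _) (toℕ-mod-≈ _) ⟩
      (toℕ u * toℕ (pt t) + (V + negate (c * w * X))) % p           ≡⟨ +-congʳ _ (*-cong (toℕ-mod-≈ _) (toℕ-mod-≈ _)) ⟩
      (c * w * (X + t * D) + (V + negate (c * w * X))) % p          ≡⟨ ≈-reflexive (rearrange c w X t D V _) ⟩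
      (c * t * (w * D) + V + (c * w * X + negate (c * w * X))) % p  ≡⟨ +-cong (+-congʳ V (*-inverse (c * t))) (+-negateʳ _) ⟩
      (c * t + V + 0) % p                                           ≡⟨ ≈-reflexive (+-identityʳ _) ⟩
      (c * t + V) % p                                               ∎
      where
      rearrange : ∀ c w X t D V n → c * w * (X + t * D) + (V + n) ≡ c * t * (w * D) + V + (c * w * X + n)
      rearrange = solve-∀

Gap : (ℕ → Set) → ℕ → ℕ → Set
Gap P c e = ∀ t → c ≤ t → t < e → ¬ P t

gap-empty : ∀ {P : ℕ → Set} {c e} → e ≤ c → Gap P c e
gap-empty e≤c t c≤t t<e = contradiction (≤-trans e≤c c≤t) (<⇒≱ t<e)

first-from : ∀ {P : ℕ → Set} → Decidable P → ∀ c e →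
             Gap P c e ⊎ ∃ λ a → c ≤ a × a < e × P a × Gap P c a
first-from P? c zero = inj₁ λ _ _ ()
first-from P? c (suc e) with first-from P? c e
... | inj₂ (a , c≤a , a<e , Pa , gap) = inj₂ (a , c≤a , m<n⇒m<1+n a<e , Pa , gap)
... | inj₁ gap with (c ≤? e) ×-dec P? e
...   | yes (c≤e , Pe) = inj₂ (e , c≤e , n<1+n e , Pe , gap)
...   | no ¬[c≤e×Pe] = inj₁ extended
  where
  extended : Gap _ c (suc e)
  extended t c≤t t<1+e with m<1+n⇒m<n∨m≡n t<1+e
  ... | inj₁ t<e  = gap t c≤t t<e
  ... | inj₂ refl = λ Pt → ¬[c≤e×Pe] (c≤t , Pt)

InBlock : ℕ → ℕ → ℕ → Set
InBlock a k t = ∃ λ i → i < k × t ≡ a + i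

in-block : ∀ {a k t} → a ≤ t → t < a + k → InBlock a k t
in-block {a} {k} a≤t t<a+k with m≤n⇒∃[o]m+o≡n a≤t
... | i , refl = i , +-cancelˡ-< a i k t<a+k , refl

module Runs {Q : ℕ → Set} (Q? : Decidable Q) (N : ℕ) (¬Q0 : ¬ Q 0) (¬QN : ¬ Q N) where

  Block : ℕ → ℕ → Set
  Block a k = ∀ i → i < k → Q (a + i)

  record Run (a k : ℕ) : Set where
    field
      start>0  : 1 ≤ a
      length>0 : 1 ≤ k
      end≤N    : a + k ≤ N
      before   : ¬ Q (pred a)
      block    : Block a k
      after    : ¬ Q (a + k)

  open Run

  next-run : ∀ c → ¬ Q c → Gap Q c N ⊎ ∃₂ λ a k → Run a k × c < a × Gap Q c a
  next-run c ¬Qc with first-from Q? c N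
  ... | inj₁ gap = inj₁ gap
  ... | inj₂ (zero , _ , _ , Q0 , _) = contradiction Q0 ¬Q0
  ... | inj₂ (suc a , c≤1+a , 1+a<N , Q1+a , gap)
        with first-from (¬? ∘ Q?) (suc a) (suc N)
  ...   | inj₁ allQ = contradiction ¬QN (allQ N (<⇒≤ 1+a<N) (n<1+n N))
  ...   | inj₂ (e , 1+a≤e , e<1+N , ¬Qe , allQ) with m≤n⇒∃[o]m+o≡n 1+a≤e
  ...   | k , refl = inj₂ (suc a , k , run , c<1+a , gap)
    where
    c<1+a : c < suc a
    c<1+a = ≤∧≢⇒< c≤1+a λ { refl → ¬Qc Q1+a }
    k>0 : ∀ {k} → ¬ Q (suc a + k) → 1 ≤ k
    k>0 {zero}  ¬Q = contradiction (subst Q (sym (+-identityʳ (suc a))) Q1+a) ¬Q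
    k>0 {suc k} _  = s≤s z≤n
    run : Run (suc a) k
    run = record
      { start>0  = s≤s z≤n
      ; length>0 = k>0 ¬Qe
      ; end≤N    = m<1+n⇒m≤n e<1+N
      ; before   = gap a (s≤s⁻¹ c<1+a) (n<1+n a)
      ; block    = λ i i<k → decidable-stable (Q? (suc a + i)) (allQ (suc a + i) (m≤m+n (suc a) i) (+-monoʳ-< (suc a) i<k))
      ; after    = ¬Qe
      }

  cover-by-blocks : ∀ {a₁ k₁ a₂ k₂} → Gap Q 0 a₁ → Gap Q (a₁ + k₁) a₂ → Gap Q (a₂ + k₂) N →
                    ∀ t → t < N → Q t → InBlock a₁ k₁ t ⊎ InBlock a₂ k₂ t
  cover-by-blocks {a₁} {k₁} {a₂} {k₂} gap₀ gap₁ gap₂ t t<N Qt with t <? a₁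
  ... | yes t<a₁ = contradiction Qt (gap₀ t z≤n t<a₁)
  ... | no t≮a₁ with t <? a₁ + k₁
  ...   | yes t<e₁ = inj₁ (in-block (≮⇒≥ t≮a₁) t<e₁)
  ...   | no t≮e₁ with t <? a₂
  ...     | yes t<a₂ = contradiction Qt (gap₁ t (≮⇒≥ t≮e₁) t<a₂)
  ...     | no t≮a₂ with t <? a₂ + k₂
  ...       | yes t<e₂ = inj₂ (in-block (≮⇒≥ t≮a₂) t<e₂)
  ...       | no t≮e₂ = contradiction Qt (gap₂ t (≮⇒≥ t≮e₂) t<N)

  data Decomposition : Set where
    three-runs : ∀ {a₁ k₁ a₂ k₂ a₃ k₃} → Run a₁ k₁ → Run a₂ k₂ → Run a₃ k₃ →
                 a₁ < a₂ → a₂ < a₃ → Decomposition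
    two-blocks : ∀ {a₁ k₁ a₂ k₂} → a₁ + k₁ ≤ a₂ → a₂ + k₂ ≤ N → Block a₁ k₁ → Block a₂ k₂ →
                 (∀ t → t < N → Q t → InBlock a₁ k₁ t ⊎ InBlock a₂ k₂ t) → Decomposition

  private
    N+0≤N : N + 0 ≤ N
    N+0≤N = ≤-reflexive (+-identityʳ N)

  decompose : Decomposition
  decompose with next-run 0 ¬Q0
  ... | inj₁ gap₀ = two-blocks {0} {0} {N} {0} z≤n N+0≤N (λ _ ()) (λ _ ())
                      (cover-by-blocks (gap-empty ≤-refl) gap₀ (gap-empty (m≤m+n N 0)))
  ... | inj₂ (a₁ , k₁ , R₁ , _ , gap₀) with next-run (a₁ + k₁) (after R₁)
  ...   | inj₁ gap₁ = two-blocks {k₂ = 0} (end≤N R₁) N+0≤N (block R₁) (λ _ ())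
                        (cover-by-blocks gap₀ gap₁ (gap-empty (m≤m+n N 0)))
  ...   | inj₂ (a₂ , k₂ , R₂ , e₁<a₂ , gap₁) with next-run (a₂ + k₂) (after R₂)
  ...     | inj₁ gap₂ = two-blocks (<⇒≤ e₁<a₂) (end≤N R₂) (block R₁) (block R₂)
                          (cover-by-blocks gap₀ gap₁ gap₂)
  ...     | inj₂ (a₃ , k₃ , R₃ , e₂<a₃ , _) =
              three-runs R₁ R₂ R₃ (≤-<-trans (m≤m+n a₁ k₁) e₁<a₂) (≤-<-trans (m≤m+n a₂ k₂) e₂<a₃)

odd-3≤ : ∀ {p h} → p ≡ suc (2 * h) → 1 ≤ h → 3 ≤ p
odd-3≤ refl 1≤h = s≤s (*-monoʳ-≤ 2 1≤h)

half-≤ : ∀ {m h} → 2 * m ≤ suc (2 * h) → m ≤ h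
half-≤ {m} {h} 2m≤1+2h = m<1+n⇒m≤n (*-cancelˡ-< 2 m (suc h) (begin-strict
  2 * m        ≤⟨ 2m≤1+2h ⟩
  suc (2 * h)  <⟨ n<1+n _ ⟩
  2 + 2 * h    ≡⟨ *-suc 2 h ⟨
  2 * suc h    ∎))
  where open ≤-Reasoning

quarter-bound : ∀ {m h} → 4 * m < suc (2 * h) + 9 → 2 * m ≤ h + 4
quarter-bound {m} {h} 4m<2h+10 = m<1+n⇒m≤n (*-cancelˡ-< 2 (2 * m) (suc (h + 4)) (begin-strict
  2 * (2 * m)       ≡⟨ *-assoc 2 2 m ⟨
  4 * m             <⟨ 4m<2h+10 ⟩
  suc (2 * h) + 9   ≡⟨ rearrange h ⟩
  2 * suc (h + 4)   ∎))
  where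
  open ≤-Reasoning
  rearrange : ∀ h → suc (2 * h) + 9 ≡ 2 * suc (h + 4)
  rearrange = solve-∀

module ArcsInHalf (p h : ℕ) .{{_ : NonZero p}} (p≡1+2h : p ≡ suc (2 * h)) where

  open ≤-Reasoning

  Fits : ℕ → ℕ → Set
  Fits c o = (c * o) % p ≤ h

  h<p : h < p
  h<p = subst (h <_) (sym p≡1+2h) (s≤s (m≤m+n h _))

  fits-low : ∀ c o → c * o ≤ h → Fits c o
  fits-low c o c*o≤h = begin
    (c * o) % p ≡⟨ m<n⇒m%n≡m (≤-<-trans c*o≤h h<p) ⟩
    c * o       ≤⟨ c*o≤h ⟩
    h           ∎

  fits-wrap : ∀ c o {e} → c * o ≡ p + e → e ≤ h → Fits c o
  fits-wrap c o {e} c*o≡p+e e≤h = begin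
    (c * o) % p ≡⟨ cong (_% p) (trans c*o≡p+e (+-comm p e)) ⟩
    (e + p) % p ≡⟨ [m+n]%n≡m%n e p ⟩
    e % p       ≡⟨ m<n⇒m%n≡m (≤-<-trans e≤h h<p) ⟩
    e           ≤⟨ e≤h ⟩
    h           ∎

  fits-1 : ∀ {o} → o ≤ h → Fits 1 o
  fits-1 {o} o≤h = fits-low 1 o (subst (_≤ h) (sym (*-identityˡ o)) o≤h)

  -- The points of two arcs of lengths k and l separated by a gap g, as offsets from the
  -- start of the first arc.
  ArcsFit : ℕ → ℕ → ℕ → ℕ → Set
  ArcsFit c k g l = (∀ i → i < k → Fits c i) × (∀ j → j < l → Fits c (k + g + j))

  -- In the spread case doubling keeps the first arc inside [0, h] and, as 2 (k + g) ≥ p and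
  -- the gap g is short, wraps the second arc around into [0, h] as well.
  data Layout : ℕ → ℕ → ℕ → ℕ → Set where
    single : ∀ {k g r} → Layout k g 0 r
    short  : ∀ {k g l r} → h ≤ r → Layout k g l r
    spread : ∀ {k g l r} → g < h → 1 ≤ l → p ≤ 2 * (k + g) → Layout k g l r

  layout : ∀ {k g l r} → k + g + l + r ≡ p → Layout k g l r ⊎ Layout l r k g
  layout {k} {g} {l} {r} sum with l ≟ 0 | k ≟ 0
  ... | yes refl | _        = inj₁ single
  ... | no _     | yes refl = inj₂ single
  ... | no l≢0   | no k≢0 with h ≤? r | h ≤? g
  ...   | yes h≤r | _       = inj₁ (short h≤r)
  ...   | no _    | yes h≤g = inj₂ (short h≤g)
  ...   | no h≰r  | no h≰g with p ≤? 2 * (k + g)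
  ...     | yes p≤2[k+g] = inj₁ (spread (≰⇒> h≰g) (n≢0⇒n>0 l≢0) p≤2[k+g])
  ...     | no p≰2[k+g] = inj₂ (spread (≰⇒> h≰r) (n≢0⇒n>0 k≢0) p≤2[l+r])
    where
    p≤2[l+r] : p ≤ 2 * (l + r)
    p≤2[l+r] = +-cancelʳ-≤ (2 * (k + g)) p (2 * (l + r)) (begin
      p + 2 * (k + g)           ≤⟨ +-monoʳ-≤ p (<⇒≤ (≰⇒> p≰2[k+g])) ⟩
      p + p                     ≡⟨ cong₂ _+_ sum sum ⟨
      (k + g + l + r) + (k + g + l + r) ≡⟨ rearrange k g l r ⟩
      2 * (l + r) + 2 * (k + g) ∎)
      where
      rearrange : ∀ k g l r → (k + g + l + r) + (k + g + l + r) ≡ 2 * (l + r) + 2 * (k + g)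
      rearrange = solve-∀

  layout-fits : ∀ {k g l r} → 1 ≤ h → k + g + l + r ≡ p → 2 * (k + l) ≤ h + 4 →
                Layout k g l r → ∃ λ c → (c ≡ 1 ⊎ c ≡ 2) × ArcsFit c k g l
  layout-fits {k} 1≤h _ 2[k+0]≤h+4 single = 1 , inj₁ refl , first , λ _ ()
    where
    first : ∀ i → i < k → Fits 1 i
    first i i<k = fits-1 (half-≤ (+-cancelʳ-≤ 2 (2 * i) (suc (2 * h)) (begin
      2 * i + 2           ≡⟨ +-comm (2 * i) 2 ⟩
      2 + 2 * i           ≡⟨ *-suc 2 i ⟨
      2 * suc i           ≤⟨ *-monoʳ-≤ 2 (≤-trans i<k (m≤m+n k 0)) ⟩
      2 * (k + 0)         ≤⟨ 2[k+0]≤h+4 ⟩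
      h + 4               ≤⟨ +-monoʳ-≤ h (+-monoʳ-≤ 3 1≤h) ⟩
      h + (3 + h)         ≡⟨ rearrange h ⟩
      suc (2 * h) + 2     ∎)))
      where
      rearrange : ∀ h → h + (3 + h) ≡ suc (2 * h) + 2
      rearrange = solve-∀
  layout-fits {k} {g} {l} {r} _ sum _ (short h≤r) =
    1 , inj₁ refl , (λ i i<k → below (≤-trans i<k (≤-trans (m≤m+n k g) (m≤m+n (k + g) l))))
                  , (λ j j<l → below (+-monoʳ-< (k + g) j<l))
    where
    span≤1+h : k + g + l ≤ suc h
    span≤1+h = +-cancelʳ-≤ h (k + g + l) (suc h) (begin
      k + g + l + h ≤⟨ +-monoʳ-≤ (k + g + l) h≤r ⟩
      k + g + l + r ≡⟨ trans sum p≡1+2h ⟩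
      suc (2 * h)   ≡⟨ cong suc (cong (h +_) (+-identityʳ h)) ⟩
      suc h + h     ∎)
    below : ∀ {o} → o < k + g + l → Fits 1 o
    below o<span = fits-1 (m<1+n⇒m≤n (≤-trans o<span span≤1+h))
  layout-fits {k} {g} {l} {r} _ _ 2[k+l]≤h+4 (spread g<h 1≤l p≤2[k+g]) =
    2 , inj₂ refl , first , second
    where
    first : ∀ i → i < k → Fits 2 i
    first i i<k = fits-low 2 i (+-cancelʳ-≤ 4 (2 * i) h (begin
      2 * i + 4          ≡⟨ rearrange i ⟩
      2 * suc i + 2 * 1  ≤⟨ +-mono-≤ (*-monoʳ-≤ 2 i<k) (*-monoʳ-≤ 2 1≤l) ⟩
      2 * k + 2 * l      ≡⟨ *-distribˡ-+ 2 k l ⟨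
      2 * (k + l)        ≤⟨ 2[k+l]≤h+4 ⟩
      h + 4              ∎))
      where
      rearrange : ∀ i → 2 * i + 4 ≡ 2 * suc i + 2 * 1
      rearrange = solve-∀
    second : ∀ j → j < l → Fits 2 (k + g + j)
    second j j<l with m≤n⇒∃[o]m+o≡n (≤-trans p≤2[k+g] (*-monoʳ-≤ 2 (m≤m+n (k + g) j)))
    ... | e , p+e≡2[k+g+j] = fits-wrap 2 (k + g + j) (sym p+e≡2[k+g+j]) (+-cancelˡ-≤ p e h (begin
      p + e               ≡⟨ p+e≡2[k+g+j] ⟩
      2 * (k + g + j)     ≤⟨ +-cancelʳ-≤ 4 (2 * (k + g + j)) (p + h) 2[k+g+j]+4≤p+h+4 ⟩
      p + h               ∎))
      where
      2[k+g+j]+4≤p+h+4 : 2 * (k + g + j) + 4 ≤ p + h + 4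
      2[k+g+j]+4≤p+h+4 = begin
        2 * (k + g + j) + 4        ≡⟨ rearrange₁ k g j ⟩
        2 * (k + suc j) + 2 * suc g ≤⟨ +-mono-≤ (*-monoʳ-≤ 2 (+-monoʳ-≤ k j<l)) (*-monoʳ-≤ 2 g<h) ⟩
        2 * (k + l) + 2 * h        ≤⟨ +-monoˡ-≤ (2 * h) 2[k+l]≤h+4 ⟩
        h + 4 + 2 * h              ≤⟨ m≤n+m _ 1 ⟩
        1 + (h + 4 + 2 * h)        ≡⟨ rearrange₂ h ⟩
        suc (2 * h) + h + 4        ≡⟨ cong (λ q → q + h + 4) p≡1+2h ⟨
        p + h + 4                  ∎
        where
        rearrange₁ : ∀ k g j → 2 * (k + g + j) + 4 ≡ 2 * (k + suc j) + 2 * suc g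
        rearrange₁ = solve-∀
        rearrange₂ : ∀ h → 1 + (h + 4 + 2 * h) ≡ suc (2 * h) + h + 4
        rearrange₂ = solve-∀

  arcs-fit : ∀ {k g l r} → 1 ≤ h → k + g + l + r ≡ p → 2 * (k + l) ≤ h + 4 →
             ∃ λ c → (c ≡ 1 ⊎ c ≡ 2) × (ArcsFit c k g l ⊎ ArcsFit c l r k)
  arcs-fit {k} {g} {l} {r} 1≤h sum 2[k+l]≤h+4 with layout sum
  ... | inj₁ L = map₂ (map₂ inj₁) (layout-fits 1≤h sum 2[k+l]≤h+4 L)
  ... | inj₂ L = map₂ (map₂ inj₂) (layout-fits 1≤h (trans (rotate k g l r) sum) 2[l+k]≤h+4 L)
    where
    rotate : ∀ k g l r → l + r + k + g ≡ k + g + l + r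
    rotate = solve-∀
    2[l+k]≤h+4 : 2 * (l + k) ≤ h + 4
    2[l+k]≤h+4 = subst (λ n → 2 * n ≤ h + 4) (+-comm k l) 2[k+l]≤h+4

two-of-three : ∀ {A : Set} (L : List A) → length L ≤ 2 → ∀ {x y z} → x ∈ₗ L → y ∈ₗ L → z ∈ₗ L →
               x ≡ y ⊎ x ≡ z ⊎ y ≡ z
two-of-three (_ ∷ [])     _ (here refl) (here refl) _ = inj₁ refl
two-of-three (_ ∷ _ ∷ []) _ (here refl) (here refl) _ = inj₁ refl
two-of-three (_ ∷ _ ∷ []) _ (there (here refl)) (there (here refl)) _ = inj₁ refl
two-of-three (_ ∷ _ ∷ []) _ (here refl) (there (here refl)) (here refl) = inj₂ (inj₁ refl)
two-of-three (_ ∷ _ ∷ []) _ (here refl) (there (here refl)) (there (here refl)) = inj₂ (inj₂ refl)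
two-of-three (_ ∷ _ ∷ []) _ (there (here refl)) (here refl) (here refl) = inj₂ (inj₂ refl)
two-of-three (_ ∷ _ ∷ []) _ (there (here refl)) (here refl) (there (here refl)) = inj₂ (inj₁ refl)
two-of-three (_ ∷ _ ∷ _ ∷ _) (s≤s (s≤s ())) _ _ _

count-injection : ∀ {n} m (Z : Subset n) (f : ℕ → Fin n) →
                  (∀ {i j} → i < m → j < m → f i ≡ f j → i ≡ j) → (∀ {i} → i < m → f i ∈ Z) → m ≤ ∣ Z ∣
count-injection zero    Z f _   _   = z≤n
count-injection (suc m) Z f inj ∈Z = ≤-trans (s≤s size-rest) (x∈p⇒∣p-x∣<∣p∣ (∈Z ≤-refl))
  where
  size-rest : m ≤ ∣ (Z - f m) ∣
  size-rest = count-injection m (Z - f m) f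
    (λ i<m j<m → inj (m<n⇒m<1+n i<m) (m<n⇒m<1+n j<m))
    (λ {i} i<m → x∈p∧x≢y⇒x∈p-y (∈Z (m<n⇒m<1+n i<m)) (<⇒≢ i<m ∘ inj (m<n⇒m<1+n i<m) ≤-refl))

module Walk (p h : ℕ) .{{_ : NonZero p}} (p≡1+2h : p ≡ suc (2 * h)) (1≤h : 1 ≤ h)
               (Z : Subset p) (x d : Fin p) (x∉Z : x ∉ Z)
               (w : ℕ) (w*d≈1 : Congruence._≈_ p (w * toℕ d) 1) where

  open Congruence p
  open Progression p x d w w*d≈1
  open ArcsInHalf p h p≡1+2h

  Q : ℕ → Set
  Q t = pt t ∈ Z

  ¬Q0 : ¬ Q 0
  ¬Q0 = x∉Z ∘ subst (_∈ Z) pt-zero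

  ¬Qp : ¬ Q p
  ¬Qp = ¬Q0 ∘ subst (_∈ Z) (pt-cong p≈0)

  open Runs (λ t → pt t ∈? Z) p ¬Q0 ¬Qp
  open Run

  Q-cong : ∀ {s t} → s ≈ t → Q s → Q t
  Q-cong s≈t = subst (_∈ Z) (pt-cong s≈t)

  pt-first : ∀ a → pt a ≡ term p (pt a) d 0
  pt-first a = sym (trans (term-pt a 0) (cong pt (+-identityʳ a)))

  ap-in-Z : ∀ {b l} → APSub p b d l Z → ∀ i → i < l → Q (index b + i)
  ap-in-Z {b} sub i i<l = subst (_∈ Z) (term-index b i) (sub _ (i , i<l , refl))

  run-maximal : ∀ {a k} → Run a k → ∀ b l → APSub p b d l Z →
                APIncl p d (pt a) k b l → APIncl p d b l (pt a) k
  run-maximal {zero} R = contradiction (start>0 R) λ ()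
  run-maximal {suc a} {k} R b l sub incl y (i , i<l , y≡)
    with incl (pt (suc a)) (0 , length>0 R , pt-first (suc a))
  ... | suc i₀ , 1+i₀<l , start≡ =
    contradiction (ap-in-Z sub i₀ (<⇒≤ 1+i₀<l)) (before R ∘ Q-cong {index b + i₀} {a} (sym a≈))
    where
    a≈ : a ≈ index b + i₀
    a≈ = suc-injective-≈ (trans (pt-injective (trans start≡ (term-index b (suc i₀))))
                                (≈-reflexive (+-suc (index b) i₀)))
  ... | zero , _ , start≡ = within
    where
    b≈1+a : index b ≈ suc a
    b≈1+a = trans (≈-reflexive (sym (+-identityʳ (index b)))) (sym (pt-injective (trans start≡ (term-index b 0))))
    within : InAP p (pt (suc a)) d k y
    within with i <? k
    ... | yes i<k = i , i<k , (begin
      y                      ≡⟨ y≡ ⟩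
      term p b d i           ≡⟨ term-index b i ⟩
      pt (index b + i)       ≡⟨ pt-cong {index b + i} {suc a + i} (+-congʳ i b≈1+a) ⟩
      pt (suc a + i)         ≡⟨ term-pt (suc a) i ⟨
      term p (pt (suc a)) d i ∎)
      where open ≡-Reasoning
    ... | no i≮k =
      contradiction (ap-in-Z sub k (≤-<-trans (≮⇒≥ i≮k) i<l)) (after R ∘ Q-cong {index b + k} {suc a + k} (+-congʳ k b≈1+a))

  run-component : ∀ {a k} → Run a k → IsComponent p d Z (pt a) k
  run-component {a} {k} R =
    (length>0 R , ≤-trans (m≤n+m k a) (end≤N R)) , contained , λ b l _ → run-maximal R b l
    where
    contained : APSub p (pt a) d k Z
    contained y (i , i<k , y≡) = subst (_∈ Z) (sym (trans y≡ (term-pt a i))) (block R i i<k)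

  run-start<p : ∀ {a k} → Run a k → a < p
  run-start<p {a} {k} R = <-≤-trans (m<m+n a (length>0 R)) (end≤N R)

  runs-distinct : ∀ {a k a′ k′} → Run a k → Run a′ k′ → a < a′ → ¬ APIncl p d (pt a) k (pt a′) k′
  runs-distinct {a} {k} {a′} {k′} R R′ a<a′ incl with incl (pt a) (0 , length>0 R , pt-first a)
  ... | m , m<k′ , start≡ = <⇒≱ a<a′ (subst (a′ ≤_) (sym a≡a′+m) (m≤m+n a′ m))
    where
    a≡a′+m : a ≡ a′ + m
    a≡a′+m = ≈⇒≡ (run-start<p R) (<-≤-trans (+-monoʳ-< a′ m<k′) (end≤N R′))
                 (pt-injective (trans start≡ (term-pt a′ m)))

  no-three-runs : AtMostComponents p d Z 2 → ∀ {a₁ k₁ a₂ k₂ a₃ k₃} →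
                  Run a₁ k₁ → Run a₂ k₂ → Run a₃ k₃ → a₁ < a₂ → a₂ < a₃ → ⊥
  no-three-runs (L , length≤2 , listed) R₁ R₂ R₃ a₁<a₂ a₂<a₃
    with listed _ _ (run-component R₁) | listed _ _ (run-component R₂) | listed _ _ (run-component R₃)
  ... | _ , _ , ∈₁ , ⊆₁ , _ | _ , _ , ∈₂ , ⊆₂ , ⊇₂ | _ , _ , ∈₃ , _ , ⊇₃
    with two-of-three L length≤2 ∈₁ ∈₂ ∈₃
  ... | inj₁ refl        = runs-distinct R₁ R₂ a₁<a₂ (λ y → ⊇₂ y ∘ ⊆₁ y)
  ... | inj₂ (inj₁ refl) = runs-distinct R₁ R₃ (<-trans a₁<a₂ a₂<a₃) (λ y → ⊇₃ y ∘ ⊆₁ y)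
  ... | inj₂ (inj₂ refl) = runs-distinct R₂ R₃ a₂<a₃ (λ y → ⊇₃ y ∘ ⊆₂ y)

  blocks-size : ∀ {a₁ k₁ a₂ k₂} → a₁ + k₁ ≤ a₂ → a₂ + k₂ ≤ p → Block a₁ k₁ → Block a₂ k₂ → k₁ + k₂ ≤ ∣ Z ∣
  blocks-size {a₁} {k₁} {a₂} {k₂} e₁≤a₂ e₂≤p block₁ block₂ =
    count-injection (k₁ + k₂) Z (pt ∘ position)
      (λ i< j< → position-injective ∘ ≈⇒≡ (proj₁ (position-in i<)) (proj₁ (position-in j<)) ∘ pt-injective)
      (proj₂ ∘ position-in)
    where
    position : ℕ → ℕ
    position i with i <? k₁
    ... | yes _ = a₁ + i
    ... | no _  = a₂ + (i ∸ k₁)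

    position-in : ∀ {i} → i < k₁ + k₂ → position i < p × Q (position i)
    position-in {i} i<k₁+k₂ with i <? k₁
    ... | yes i<k₁ = <-≤-trans (+-monoʳ-< a₁ i<k₁) (≤-trans e₁≤a₂ (≤-trans (m≤m+n a₂ k₂) e₂≤p)) , block₁ i i<k₁
    ... | no i≮k₁ = <-≤-trans (+-monoʳ-< a₂ i∸k₁<k₂) e₂≤p , block₂ (i ∸ k₁) i∸k₁<k₂
      where
      i∸k₁<k₂ : i ∸ k₁ < k₂
      i∸k₁<k₂ = subst (i ∸ k₁ <_) (m+n∸m≡n k₁ k₂) (∸-monoˡ-< i<k₁+k₂ (≮⇒≥ i≮k₁))

    first-before-second : ∀ {i} j → i < k₁ → a₁ + i < a₂ + j
    first-before-second {i} j i<k₁ = <-≤-trans (+-monoʳ-< a₁ i<k₁) (≤-trans e₁≤a₂ (m≤m+n a₂ j))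

    position-injective : ∀ {i j} → position i ≡ position j → i ≡ j
    position-injective {i} {j} eq with i <? k₁ | j <? k₁
    ... | yes _    | yes _    = +-cancelˡ-≡ a₁ i j eq
    ... | yes i<k₁ | no _     = contradiction eq (<⇒≢ (first-before-second (j ∸ k₁) i<k₁))
    ... | no _     | yes j<k₁ = contradiction (sym eq) (<⇒≢ (first-before-second (i ∸ k₁) j<k₁))
    ... | no i≮k₁  | no j≮k₁  = begin
      i              ≡⟨ m+[n∸m]≡n (≮⇒≥ i≮k₁) ⟨
      k₁ + (i ∸ k₁)  ≡⟨ cong (k₁ +_) (+-cancelˡ-≡ a₂ _ _ eq) ⟩
      k₁ + (j ∸ k₁)  ≡⟨ m+[n∸m]≡n (≮⇒≥ j≮k₁) ⟩
      j              ∎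
      where open ≡-Reasoning

  AffineImageInHalf : Set
  AffineImageInHalf = ∃[ u ] ∃[ v ] (u ≢ [_] p 0 × (∀ z → z ∈ Z → toℕ (_⊕_ p (_⊗_ p u z) v) ≤ h))

  one-or-two≉0 : ∀ {c} → c ≡ 1 ⊎ c ≡ 2 → ¬ c ≈ 0
  one-or-two≉0 c∈12 c≈0 = contradiction (≈⇒≡ (<-≤-trans (c<3 c∈12) 3≤p) (<-≤-trans z<s 3≤p) c≈0) (c≢0 c∈12)
    where
    3≤p : 3 ≤ p
    3≤p = odd-3≤ p≡1+2h 1≤h
    c<3 : ∀ {c} → c ≡ 1 ⊎ c ≡ 2 → c < 3
    c<3 (inj₁ refl) = s≤s (s≤s z≤n)
    c<3 (inj₂ refl) = ≤-refl
    c≢0 : ∀ {c} → c ≡ 1 ⊎ c ≡ 2 → c ≢ 0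
    c≢0 (inj₁ refl) ()
    c≢0 (inj₂ refl) ()

  fit-by-offsets : ∀ c s → c ≡ 1 ⊎ c ≡ 2 →
                   (∀ t → t < p → Q t → ∃ λ o → Fits c o × t ≈ s + o) → AffineImageInHalf
  fit-by-offsets c s c∈12 offset with affine c (c * negate s)
  ... | u , v , u≢0 , along = u , v , u≢0 (one-or-two≉0 c∈12) , bound
    where
    bound : ∀ z → z ∈ Z → toℕ (_⊕_ p (_⊗_ p u z) v) ≤ h
    bound z z∈Z with offset (index z) (index<p z) (subst (_∈ Z) (sym (pt-index z)) z∈Z)
    ... | o , fits , t≈s+o = begin
      toℕ (_⊕_ p (_⊗_ p u z) v)              ≡⟨ cong (λ z′ → toℕ (_⊕_ p (_⊗_ p u z′) v)) (pt-index z) ⟨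
      toℕ (_⊕_ p (_⊗_ p u (pt (index z))) v) ≡⟨ along (index z) ⟩
      (c * index z + c * negate s) % p       ≡⟨ recentre c t≈s+o ⟩
      (c * o) % p                            ≤⟨ fits ⟩
      h                                      ∎
      where open ≤-Reasoning

  two-blocks-fit : 4 * ∣ Z ∣ < p + 9 → ∀ {a₁ k₁ a₂ k₂} → a₁ + k₁ ≤ a₂ → a₂ + k₂ ≤ p →
                   Block a₁ k₁ → Block a₂ k₂ → (∀ t → t < p → Q t → InBlock a₁ k₁ t ⊎ InBlock a₂ k₂ t) →
                   AffineImageInHalf
  two-blocks-fit small {a₁} {k₁} {a₂} {k₂} e₁≤a₂ e₂≤p block₁ block₂ cover
    with m≤n⇒∃[o]m+o≡n e₁≤a₂ | m≤n⇒∃[o]m+o≡n e₂≤p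
  ... | g , refl | r , e₂+r≡p with arcs-fit 1≤h sum 2[k₁+k₂]≤h+4
    where
    sum : k₁ + g + k₂ + (r + a₁) ≡ p
    sum = trans (rearrange a₁ k₁ g k₂ r) e₂+r≡p
      where
      rearrange : ∀ a₁ k₁ g k₂ r → k₁ + g + k₂ + (r + a₁) ≡ a₁ + k₁ + g + k₂ + r
      rearrange = solve-∀
    2[k₁+k₂]≤h+4 : 2 * (k₁ + k₂) ≤ h + 4
    2[k₁+k₂]≤h+4 = quarter-bound {k₁ + k₂} (≤-<-trans (*-monoʳ-≤ 4 (blocks-size e₁≤a₂ e₂≤p block₁ block₂))
                                            (subst (λ q → 4 * ∣ Z ∣ < q + 9) p≡1+2h small))
  ... | c , c∈12 , inj₁ (fit₁ , fit₂) = fit-by-offsets c a₁ c∈12 offset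
    where
    offset : ∀ t → t < p → Q t → ∃ λ o → Fits c o × t ≈ a₁ + o
    offset t t<p Qt with cover t t<p Qt
    ... | inj₁ (i , i<k₁ , refl) = i , fit₁ i i<k₁ , refl
    ... | inj₂ (j , j<k₂ , refl) = k₁ + g + j , fit₂ j j<k₂ , ≈-reflexive (regroup a₁ k₁ g j)
      where
      regroup : ∀ a₁ k₁ g j → a₁ + k₁ + g + j ≡ a₁ + (k₁ + g + j)
      regroup = solve-∀
  ... | c , c∈12 , inj₂ (fit₂ , fit₁) = fit-by-offsets c (a₁ + k₁ + g) c∈12 offset
    where
    offset : ∀ t → t < p → Q t → ∃ λ o → Fits c o × t ≈ a₁ + k₁ + g + o
    offset t t<p Qt with cover t t<p Qt
    ... | inj₂ (j , j<k₂ , refl) = j , fit₂ j j<k₂ , refl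
    ... | inj₁ (i , i<k₁ , refl) = k₂ + (r + a₁) + i , fit₁ i i<k₁ , sym (begin
      (a₁ + k₁ + g + (k₂ + (r + a₁) + i)) % p  ≡⟨ ≈-reflexive (rearrange a₁ k₁ g k₂ r i) ⟩
      (a₁ + k₁ + g + k₂ + r + (a₁ + i)) % p    ≡⟨ +-congʳ (a₁ + i) (trans (≈-reflexive e₂+r≡p) p≈0) ⟩
      (0 + (a₁ + i)) % p                       ∎)
      where
      open ≡-Reasoning
      rearrange : ∀ a₁ k₁ g k₂ r i → a₁ + k₁ + g + (k₂ + (r + a₁) + i) ≡ a₁ + k₁ + g + k₂ + r + (a₁ + i)
      rearrange = solve-∀

  affine-image-in-half : AtMostComponents p d Z 2 → 4 * ∣ Z ∣ < p + 9 → AffineImageInHalf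
  affine-image-in-half at-most-two small with decompose
  ... | three-runs R₁ R₂ R₃ a₁<a₂ a₂<a₃ = ⊥-elim (no-three-runs at-most-two R₁ R₂ R₃ a₁<a₂ a₂<a₃)
  ... | two-blocks e₁≤a₂ e₂≤p block₁ block₂ cover = two-blocks-fit small e₁≤a₂ e₂≤p block₁ block₂ cover

odd⇒≡1+2*half : ∀ {p} → p % 2 ≡ 1 → p ≡ suc (2 * ((p ∸ 1) / 2))
odd⇒≡1+2*half {p} p%2≡1 = begin
  p                       ≡⟨ p≡1+[p/2]*2 ⟩
  suc (p / 2 * 2)         ≡⟨ cong suc (*-comm (p / 2) 2) ⟩
  suc (2 * (p / 2))       ≡⟨ cong (λ n → suc (2 * n)) (m*n/n≡m (p / 2) 2) ⟨
  suc (2 * (p / 2 * 2 / 2)) ≡⟨ cong (λ n → suc (2 * ((n ∸ 1) / 2))) p≡1+[p/2]*2 ⟨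
  suc (2 * ((p ∸ 1) / 2)) ∎
  where
  open ≡-Reasoning
  p≡1+[p/2]*2 : p ≡ suc (p / 2 * 2)
  p≡1+[p/2]*2 = trans (m≡m%n+[m/n]*n p 2) (cong (_+ p / 2 * 2) p%2≡1)

prime-half-positive : ∀ {p h} → Prime p → p ≡ suc (2 * h) → 1 ≤ h
prime-half-positive {p} {zero} p-prime refl = contradiction (nonTrivial⇒n>1 p {{prime⇒nonTrivial p-prime}}) λ { (s≤s ()) }
prime-half-positive {h = suc _} _ _ = s≤s z≤n

inverse-mod-prime : ∀ {p} .{{_ : NonZero p}} → Prime p → ∀ n → 0 < n → n < p →
                    ∃ λ w → Congruence._≈_ p (w * n) 1
inverse-mod-prime {suc q} p-prime n n>0 n<p with coprime-Bézout (prime⇒coprime p-prime {{>-nonZero n>0}} n<p)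
... | Bézout.-+ x y 1+x[1+q]≡yn = y , (begin
  (y * n) % suc q               ≡⟨ cong (_% suc q) 1+x[1+q]≡yn ⟨
  (1 + x * suc q) % suc q       ≡⟨ [m+kn]%n≡m%n 1 x (suc q) ⟩
  1 % suc q                     ∎)
  where open ≡-Reasoning
... | Bézout.+- x y 1+yn≡x[1+q] = q * y , (begin
  (q * y * n) % suc q                   ≡⟨ [m+kn]%n≡m%n (q * y * n) 1 (suc q) ⟨
  (q * y * n + 1 * suc q) % suc q       ≡⟨ cong (_% suc q) (rearrange₁ q y n) ⟩
  (q * (1 + y * n) + 1) % suc q         ≡⟨ cong (λ m → (q * m + 1) % suc q) 1+yn≡x[1+q] ⟩
  (q * (x * suc q) + 1) % suc q         ≡⟨ cong (_% suc q) (rearrange₂ q x) ⟩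
  (1 + q * x * suc q) % suc q           ≡⟨ [m+kn]%n≡m%n 1 (q * x) (suc q) ⟩
  1 % suc q                             ∎)
  where
  open ≡-Reasoning
  rearrange₁ : ∀ q y n → q * y * n + 1 * suc q ≡ q * (1 + y * n) + 1
  rearrange₁ = solve-∀
  rearrange₂ : ∀ q x → q * (x * suc q) + 1 ≡ 1 + q * x * suc q
  rearrange₂ = solve-∀

missing-point : ∀ {p} (Z : Subset p) → 3 ≤ p → 4 * ∣ Z ∣ < p + 9 → ∃ λ x → x ∉ Z
missing-point {p} Z 3≤p small with all? (_∈? Z)
... | no ¬all = ¬∀⟶∃¬ p (_∈ Z) (_∈? Z) ¬all
... | yes all = contradiction (begin-strict
  4 * p     ≤⟨ *-monoʳ-≤ 4 (subst (_≤ ∣ Z ∣) (∣⊤∣≡n p) (p⊆q⇒∣p∣≤∣q∣ {p = ⊤} λ {y} _ → all y)) ⟩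
  4 * ∣ Z ∣ <⟨ small ⟩
  p + 9     ≤⟨ +-monoʳ-≤ p (*-monoʳ-≤ 3 3≤p) ⟩
  p + 3 * p ≡⟨ rearrange p ⟩
  4 * p     ∎) (<-irrefl refl)
  where
  open ≤-Reasoning
  rearrange : ∀ p → p + 3 * p ≡ 4 * p
  rearrange = solve-∀

lemma5p2 : (p : ℕ) .{{_ : NonZero p}} → Prime p → p % 2 ≡ 1 →
    (Z : Subset p) → [_] p 0 ∈ Z → 4 * ∣ Z ∣ < p + 9 →
    (∃[ d ] (d ≢ [_] p 0 × AtMostComponents p d Z 2)) →
    ∃[ u ] ∃[ v ] (u ≢ [_] p 0 ×
      (∀ z → z ∈ Z → toℕ (_⊕_ p (_⊗_ p u z) v) ≤ (p ∸ 1) / 2))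
lemma5p2 p p-prime p-odd Z _ small (d , d≢0 , at-most-two) =
  let (x , x∉Z)   = missing-point Z 3≤p small
      (w , w*d≈1) = inverse-mod-prime p-prime (toℕ d) (Congruence.toℕ>0 p d≢0) (toℕ<n d)
  in Walk.affine-image-in-half p h p≡1+2h 1≤h Z x d x∉Z w w*d≈1 at-most-two small
  where
  h : ℕ
  h = (p ∸ 1) / 2
  p≡1+2h : p ≡ suc (2 * h)
  p≡1+2h = odd⇒≡1+2*half p-odd
  1≤h : 1 ≤ h
  1≤h = prime-half-positive p-prime p≡1+2h
  3≤p : 3 ≤ p
  3≤p = odd-3≤ p≡1+2h 1≤h
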